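{- For each integer $k \ge 1$ let $D_k$ be the determinant of the $k \times k$ matrix $A^{(k)} = (a_{ij})_{1 \le i,j \le k}$ with entries \[ a_{ij} = \begin{cases} \dfrac{1}{(2(j-i)+3)!} & \text{if } j \ge i,\\[4pt] 1 & \text{if } j = i-1,\\[2pt] 0 & \text{if } j < i-1, \end{cases} \] so that, for example, $D_1 = \frac{1}{3!}$, $D_2 = \det\begin{pmatrix} \frac{1}{3!} & \frac{1}{5!} \\ 1 & \frac{1}{3!}\end{pmatrix}$, $D_3 = \det\begin{pmatrix} \frac{1}{3!} & \frac{1}{5!} & \frac{1}{7!} \\ 1 & \frac{1}{3!} & \frac{1}{5!} \\ 0 & 1 & \frac{1}{3!}\end{pmatrix}$. Then for every integer $p \ge 1$, the Bernoulli number $B_{2p}$ satisfies \[ B_{2p} = -2p + \left(\frac{3}{2}\right)^{2p}\left\{1 + (2p)!\sum_{k=1}^{p} \frac{(-1)^k D_k}{3^{2k}\,\bigl[2(p-k)\bigr]!}\right\}, \] where $0! = 1$.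
   Context: $B_n$ denotes the $n$-th Bernoulli number, defined by $\frac{t}{e^t - 1} = \sum_{n \ge 0} B_n \frac{t^n}{n!}$ (so $B_2 = \frac16$, $B_4 = -\frac{1}{30}$). -}

module Defs where

open import Data.Nat as ℕ using (ℕ; zero; suc; _!; _≤ᵇ_; _≡ᵇ_)
open import Data.Nat.Properties using (_!≢0)
open import Data.Nat.Combinatorics using (_C_)
open import Data.Integer using (+_)
open import Data.Fin using (Fin; toℕ; punchIn) renaming (zero to fzero; suc to fsuc)
open import Data.Bool using (if_then_else_)
open import Data.Rational using (ℚ; _/_; _+_; _*_; -_; _-_; 0ℚ; 1ℚ)

ℕ→ℚ : ℕ → ℚ
ℕ→ℚ n = (+ n) / 1

inv! : ℕ → ℚ
inv! n = _/_ (+ 1) (n !) {{n !≢0}}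

_^ℚ_ : ℚ → ℕ → ℚ
q ^ℚ zero = 1ℚ
q ^ℚ suc n = q * (q ^ℚ n)

sgn : ℕ → ℚ
sgn n = (- 1ℚ) ^ℚ n

sumTo : ℕ → (ℕ → ℚ) → ℚ
sumTo zero f = 0ℚ
sumTo (suc n) f = sumTo n f + f n

sumFin : (n : ℕ) → (Fin n → ℚ) → ℚ
sumFin zero f = 0ℚ
sumFin (suc n) f = f fzero + sumFin n (λ i → f (fsuc i))

det : (n : ℕ) → (Fin n → Fin n → ℚ) → ℚ
det zero M = 1ℚ
det (suc n) M =
  sumFin (suc n) (λ j → sgn (toℕ j) * M fzero j * det n (λ i k → M (fsuc i) (punchIn j k)))

-- Bernoulli numbers via the recurrence equivalent to t/(e^t-1) = Σ B_n t^n/n!: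
--   B_0 = 1,  Σ_{j=0}^{m} C(m+1,j) B_j = 0  for m ≥ 1,
-- i.e. B_m = -(1/(m+1)) Σ_{j<m} C(m+1,j) B_j.
-- table n j = B_j for j ≤ n
bernTable : ℕ → ℕ → ℚ
bernTable zero j = 1ℚ
bernTable (suc n) j =
  if j ≤ᵇ n then bernTable n j
  else (- (_/_ (+ 1) (suc (suc n)))) * sumTo (suc n) (λ i → ℕ→ℚ (suc (suc n) C i) * bernTable n i)

bernoulli : ℕ → ℚ
bernoulli n = bernTable n n

-- the matrix A^(k), indices 0-based (differences j - i agree with 1-based ones)
A : (k : ℕ) → Fin k → Fin k → ℚ
A k i j =
  if toℕ i ≤ᵇ toℕ j then inv! (2 ℕ.* (toℕ j ℕ.∸ toℕ i) ℕ.+ 3)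
  else (if suc (toℕ j) ≡ᵇ toℕ i then 1ℚ else 0ℚ)

D : ℕ → ℚ
D k = det k (A k)

-- Write B(t) = t / (eᵗ - 1) = Σ Bₙ tⁿ / n!. Expanding D (k + 1) along its first row gives
-- D (k + 1) = Σⱼ (-1)ʲ D (k - j) / (2j + 3)!, which says that Σ (-1)ᵏ Dₖ xᵏ is the reciprocal of
-- Σ xᵐ / (2m + 1)!, that is, of sinh t / t at x = t². The Bernoulli recurrence says that
-- (e²ᵗ - 1) B(2t) = 2t, and with it a computation with exponentials gives
--   sinh t · (B(2t) + t + 2t sinh 2t) = t cosh 3t,  so  B(2t) + t + 2t sinh 2t = cosh 3t · t / sinh t.
-- Comparing the coefficients of t²ᵖ and multiplying by (2p)! / 4ᵖ gives the formula.

module Submission where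

open import Defs
open import Level using (0ℓ)
open import Data.Bool using (true; false; if_then_else_)
open import Data.Fin as Fin using (Fin; toℕ; punchIn; punchOut) renaming (zero to fzero; suc to fsuc)
import Data.Fin.Properties as FinP
open import Data.Integer as ℤ using (+_)
import Data.Integer.Properties as ℤP
open import Data.Maybe using (Maybe; just; nothing)
open import Data.Nat as ℕ using (ℕ; zero; suc; _∸_; _!; _<_; _≤_; s≤s)
open import Data.Nat.Combinatorics using (_C_; k![n∸k]!∣n!; nCk≡nC[n∸k]; nC1≡n; nCn≡1)
open import Data.Nat.Combinatorics.Specification using (nCk≡n!/k![n-k]!)
import Data.Nat.Coprimality as Coprime
open import Data.Nat.DivMod using (m/n*n≡m)
import Data.Nat.Properties as ℕP
open import Data.Product using (_,_)
open import Data.Rational using (ℚ; mkℚ; _/_; _+_; _*_; -_; _-_; 0ℚ; 1ℚ)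
import Data.Rational.Properties as ℚP
open import Data.Sum using (inj₁; inj₂)
open import Relation.Binary.PropositionalEquality
import Relation.Binary.Reasoning.Setoid as SetoidReasoning
open import Relation.Nullary.Decidable using (dec⇒maybe; yes; no)
open import Algebra.Bundles using (CommutativeRing)
import Algebra.Construct.Pointwise as Pointwise
import Algebra.Solver.Ring as RingSolver
open import Algebra.Solver.Ring.AlmostCommutativeRing as ACR using (_-Raw-AlmostCommutative⟶_)
open import Tactic.RingSolver using (solve-∀)
open import Tactic.RingSolver.Core.AlmostCommutativeRing using (AlmostCommutativeRing; fromCommutativeRing)

open ℚP using (+-*-commutativeRing)
open CommutativeRing +-*-commutativeRing
  using (+-commutativeSemigroup; *-commutativeSemigroup; commutativeSemiring; +-rawMonoid; ring; rawRing)
open import Algebra.Properties.CommutativeSemigroup +-commutativeSemigroup using (interchange)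
open import Algebra.Properties.CommutativeSemigroup *-commutativeSemigroup using (x∙yz≈y∙xz)
open import Algebra.Properties.Ring ring using (-‿involutive; -1*x≈-x)
open import Algebra.Definitions.RawMonoid +-rawMonoid using (sum; _×_)
open import Algebra.Properties.CommutativeSemiring.Exp commutativeSemiring using (_^_; ^-homo-*; ^-distrib-*)
import Algebra.Properties.CommutativeSemiring.Binomial commutativeSemiring as Binomial

ℚ-ring : AlmostCommutativeRing 0ℓ 0ℓ
ℚ-ring = fromCommutativeRing +-*-commutativeRing (λ q → dec⇒maybe (0ℚ ℚP.≟ q))

ℕ→ℚ-mkℚ : ∀ n → ℕ→ℚ n ≡ mkℚ (+ n) 0 (Coprime.sym (Coprime.1-coprimeTo n))
ℕ→ℚ-mkℚ n = ℚP.normalize-coprime _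

ℕ→ℚ-+ : ∀ m n → ℕ→ℚ (m ℕ.+ n) ≡ ℕ→ℚ m + ℕ→ℚ n
ℕ→ℚ-+ m n = begin
  ℕ→ℚ (m ℕ.+ n)                       ≡⟨ cong (_/ 1) (cong₂ ℤ._+_ (ℤP.*-identityʳ (+ m)) (ℤP.*-identityʳ (+ n))) ⟨
  (+ m ℤ.* + 1 ℤ.+ + n ℤ.* + 1) / 1  ≡⟨ cong₂ _+_ (ℕ→ℚ-mkℚ m) (ℕ→ℚ-mkℚ n) ⟨
  ℕ→ℚ m + ℕ→ℚ n                       ∎
  where open ≡-Reasoning

ℕ→ℚ-* : ∀ m n → ℕ→ℚ (m ℕ.* n) ≡ ℕ→ℚ m * ℕ→ℚ n
ℕ→ℚ-* m n = begin
  ℕ→ℚ (m ℕ.* n)      ≡⟨ cong (_/ 1) (ℤP.pos-* m n) ⟩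
  (+ m ℤ.* + n) / 1  ≡⟨ cong₂ _*_ (ℕ→ℚ-mkℚ m) (ℕ→ℚ-mkℚ n) ⟨
  ℕ→ℚ m * ℕ→ℚ n      ∎
  where open ≡-Reasoning

1/n*n≡1 : ∀ n .{{_ : ℕ.NonZero n}} → (+ 1 / n) * ℕ→ℚ n ≡ 1ℚ
1/n*n≡1 (suc m) = begin
  (+ 1 / suc m) * ℕ→ℚ (suc m)          ≡⟨ cong₂ _*_ (ℚP.normalize-coprime c₁) (ℕ→ℚ-mkℚ (suc m)) ⟩
  mkℚ (+ 1) m c₁ * mkℚ (+ suc m) 0 c₂  ≡⟨ ℚP.*-inverseˡ (mkℚ (+ suc m) 0 c₂) ⟩
  1ℚ                                    ∎
  where
  open ≡-Reasoning
  c₁ = Coprime.1-coprimeTo (suc m)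
  c₂ = Coprime.sym (Coprime.1-coprimeTo (suc m))

inv!*n!≡1 : ∀ n → inv! n * ℕ→ℚ (n !) ≡ 1ℚ
inv!*n!≡1 n = 1/n*n≡1 (n !) {{n ℕP.!≢0}}

inv!*[1+n]!≡1+n : ∀ n → inv! n * ℕ→ℚ (suc n !) ≡ ℕ→ℚ (suc n)
inv!*[1+n]!≡1+n n = begin
  inv! n * ℕ→ℚ (suc n ℕ.* n !)           ≡⟨ cong (inv! n *_) (ℕ→ℚ-* (suc n) (n !)) ⟩
  inv! n * (ℕ→ℚ (suc n) * ℕ→ℚ (n !))     ≡⟨ x∙yz≈y∙xz (inv! n) (ℕ→ℚ (suc n)) (ℕ→ℚ (n !)) ⟩
  ℕ→ℚ (suc n) * (inv! n * ℕ→ℚ (n !))     ≡⟨ cong (ℕ→ℚ (suc n) *_) (inv!*n!≡1 n) ⟩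
  ℕ→ℚ (suc n) * 1ℚ                       ≡⟨ ℚP.*-identityʳ (ℕ→ℚ (suc n)) ⟩
  ℕ→ℚ (suc n)                            ∎
  where open ≡-Reasoning

nCk*k!*[n∸k]!≡n! : ∀ {n k} → k ≤ n → (n C k) ℕ.* (k ! ℕ.* (n ∸ k) !) ≡ n !
nCk*k!*[n∸k]!≡n! {n} {k} k≤n = trans (cong (ℕ._* (k ! ℕ.* (n ∸ k) !)) (nCk≡n!/k![n-k]! k≤n))
  (m/n*n≡m {{ℕP._!*_!≢0 k (n ∸ k)}} (k![n∸k]!∣n! k≤n))

nCk*inv!n≡inv!k*inv![n∸k] : ∀ {n k} → k ≤ n → ℕ→ℚ (n C k) * inv! n ≡ inv! k * inv! (n ∸ k)
nCk*inv!n≡inv!k*inv![n∸k] {n} {k} k≤n = begin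
  nCk * iN                            ≡⟨ ℚP.*-identityʳ (nCk * iN) ⟨
  nCk * iN * 1ℚ                       ≡⟨ cong (nCk * iN *_) (cong₂ _*_ (inv!*n!≡1 k) (inv!*n!≡1 (n ∸ k))) ⟨
  nCk * iN * ((iK * K) * (iL * L))    ≡⟨ regroup nCk iN iK iL K L ⟩
  (nCk * (K * L)) * iN * (iK * iL)    ≡⟨ cong (λ z → z * iN * (iK * iL)) nCk*K*L≡N ⟩
  ℕ→ℚ (n !) * iN * (iK * iL)          ≡⟨ cong (_* (iK * iL)) (trans (ℚP.*-comm _ iN) (inv!*n!≡1 n)) ⟩
  1ℚ * (iK * iL)                      ≡⟨ ℚP.*-identityˡ (iK * iL) ⟩
  iK * iL                             ∎
  where
  open ≡-Reasoning
  nCk = ℕ→ℚ (n C k); iN = inv! n; iK = inv! k; iL = inv! (n ∸ k); K = ℕ→ℚ (k !); L = ℕ→ℚ ((n ∸ k) !)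
  nCk*K*L≡N : nCk * (K * L) ≡ ℕ→ℚ (n !)
  nCk*K*L≡N = begin
    nCk * (K * L)                            ≡⟨ cong (nCk *_) (ℕ→ℚ-* (k !) ((n ∸ k) !)) ⟨
    nCk * ℕ→ℚ (k ! ℕ.* (n ∸ k) !)            ≡⟨ ℕ→ℚ-* (n C k) _ ⟨
    ℕ→ℚ ((n C k) ℕ.* (k ! ℕ.* (n ∸ k) !))    ≡⟨ cong ℕ→ℚ (nCk*k!*[n∸k]!≡n! k≤n) ⟩
    ℕ→ℚ (n !)                                ∎
  regroup : ∀ c i a b x y → c * i * ((a * x) * (b * y)) ≡ (c * (x * y)) * i * (a * b)
  regroup = solve-∀ ℚ-ring

^ℚ≡^ : ∀ q n → q ^ℚ n ≡ q ^ n
^ℚ≡^ q zero    = refl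
^ℚ≡^ q (suc n) = cong (q *_) (^ℚ≡^ q n)

^ℚ-+ : ∀ q m n → q ^ℚ (m ℕ.+ n) ≡ q ^ℚ m * q ^ℚ n
^ℚ-+ q m n = begin
  q ^ℚ (m ℕ.+ n)     ≡⟨ ^ℚ≡^ q (m ℕ.+ n) ⟩
  q ^ (m ℕ.+ n)      ≡⟨ ^-homo-* q m n ⟩
  q ^ m * q ^ n      ≡⟨ cong₂ _*_ (^ℚ≡^ q m) (^ℚ≡^ q n) ⟨
  q ^ℚ m * q ^ℚ n    ∎
  where open ≡-Reasoning

^ℚ-distrib-* : ∀ p q n → (p * q) ^ℚ n ≡ p ^ℚ n * q ^ℚ n
^ℚ-distrib-* p q n = begin
  (p * q) ^ℚ n       ≡⟨ ^ℚ≡^ (p * q) n ⟩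
  (p * q) ^ n        ≡⟨ ^-distrib-* p q n ⟩
  p ^ n * q ^ n      ≡⟨ cong₂ _*_ (^ℚ≡^ p n) (^ℚ≡^ q n) ⟨
  p ^ℚ n * q ^ℚ n    ∎
  where open ≡-Reasoning

1^ℚn≡1 : ∀ n → 1ℚ ^ℚ n ≡ 1ℚ
1^ℚn≡1 zero    = refl
1^ℚn≡1 (suc n) = trans (ℚP.*-identityˡ (1ℚ ^ℚ n)) (1^ℚn≡1 n)

sgn-+ : ∀ m n → sgn (m ℕ.+ n) ≡ sgn m * sgn n
sgn-+ = ^ℚ-+ (- 1ℚ)

sgn*sgn≡1 : ∀ n → sgn n * sgn n ≡ 1ℚ
sgn*sgn≡1 n = trans (sym (^ℚ-distrib-* (- 1ℚ) (- 1ℚ) n)) (1^ℚn≡1 n)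

double : ℕ → ℕ
double zero    = zero
double (suc m) = suc (suc (double m))

double≡2* : ∀ m → double m ≡ 2 ℕ.* m
double≡2* zero    = refl
double≡2* (suc m) = trans (cong (λ k → suc (suc k)) (double≡2* m)) (sym (ℕP.*-suc 2 m))

double-+ : ∀ m n → double (m ℕ.+ n) ≡ double m ℕ.+ double n
double-+ zero    n = refl
double-+ (suc m) n = cong (λ k → suc (suc k)) (double-+ m n)

data Parity : ℕ → Set where
  even : ∀ m → Parity (double m)
  odd  : ∀ m → Parity (suc (double m))

parity : ∀ n → Parity n
parity zero          = even zero
parity (suc zero)    = odd zero
parity (suc (suc n)) with parity n
... | even m = even (suc m)
... | odd m  = odd (suc m)

sgn-double : ∀ m → sgn (double m) ≡ 1ℚ
sgn-double zero    = refl
sgn-double (suc m) = trans (sym (ℚP.*-assoc (- 1ℚ) (- 1ℚ) (sgn (double m)))) (trans (ℚP.*-identityˡ _) (sgn-double m))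

sumTo-cong : ∀ n {f g : ℕ → ℚ} → (∀ i → i < n → f i ≡ g i) → sumTo n f ≡ sumTo n g
sumTo-cong zero    f≡g = refl
sumTo-cong (suc n) f≡g = cong₂ _+_ (sumTo-cong n (λ i i<n → f≡g i (ℕP.m<n⇒m<1+n i<n))) (f≡g n ℕP.≤-refl)

sumTo-zero : ∀ n {f : ℕ → ℚ} → (∀ i → i < n → f i ≡ 0ℚ) → sumTo n f ≡ 0ℚ
sumTo-zero zero    f≡0 = refl
sumTo-zero (suc n) f≡0 = cong₂ _+_ (sumTo-zero n (λ i i<n → f≡0 i (ℕP.m<n⇒m<1+n i<n))) (f≡0 n ℕP.≤-refl)

sumTo-distrib-+ : ∀ n (f g : ℕ → ℚ) → sumTo n (λ i → f i + g i) ≡ sumTo n f + sumTo n g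
sumTo-distrib-+ zero    f g = refl
sumTo-distrib-+ (suc n) f g = begin
  sumTo n (λ i → f i + g i) + (f n + g n)     ≡⟨ cong (_+ (f n + g n)) (sumTo-distrib-+ n f g) ⟩
  (sumTo n f + sumTo n g) + (f n + g n)       ≡⟨ interchange (sumTo n f) (sumTo n g) (f n) (g n) ⟩
  (sumTo n f + f n) + (sumTo n g + g n)       ∎
  where open ≡-Reasoning

*-distribˡ-sumTo : ∀ n c (f : ℕ → ℚ) → c * sumTo n f ≡ sumTo n (λ i → c * f i)
*-distribˡ-sumTo zero    c f = ℚP.*-zeroʳ c
*-distribˡ-sumTo (suc n) c f =
  trans (ℚP.*-distribˡ-+ c (sumTo n f) (f n)) (cong (_+ c * f n) (*-distribˡ-sumTo n c f))

sumTo-head : ∀ n (f : ℕ → ℚ) → sumTo (suc n) f ≡ f 0 + sumTo n (λ i → f (suc i))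
sumTo-head zero    f = ℚP.+-comm 0ℚ (f 0)
sumTo-head (suc n) f =
  trans (cong (_+ f (suc n)) (sumTo-head n f)) (ℚP.+-assoc (f 0) (sumTo n (λ i → f (suc i))) (f (suc n)))

sumTo-reverse : ∀ n (f : ℕ → ℚ) → sumTo n f ≡ sumTo n (λ i → f (n ∸ suc i))
sumTo-reverse zero    f = refl
sumTo-reverse (suc n) f = begin
  sumTo n f + f n                               ≡⟨ cong (_+ f n) (sumTo-reverse n f) ⟩
  sumTo n (λ i → f (n ∸ suc i)) + f n           ≡⟨ ℚP.+-comm _ (f n) ⟩
  f n + sumTo n (λ i → f (n ∸ suc i))           ≡⟨ sumTo-head n (λ i → f (n ∸ i)) ⟨
  sumTo (suc n) (λ i → f (n ∸ i))               ∎
  where open ≡-Reasoning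

sumFin-cong : ∀ n {f g : Fin n → ℚ} → (∀ j → f j ≡ g j) → sumFin n f ≡ sumFin n g
sumFin-cong zero    f≡g = refl
sumFin-cong (suc n) f≡g = cong₂ _+_ (f≡g fzero) (sumFin-cong n (λ j → f≡g (fsuc j)))

sumFin-zero : ∀ n {f : Fin n → ℚ} → (∀ j → f j ≡ 0ℚ) → sumFin n f ≡ 0ℚ
sumFin-zero zero    f≡0 = refl
sumFin-zero (suc n) f≡0 = trans (cong₂ _+_ (f≡0 fzero) (sumFin-zero n (λ j → f≡0 (fsuc j)))) (ℚP.+-identityʳ 0ℚ)

sumFin-toℕ : ∀ n (f : ℕ → ℚ) → sumFin n (λ j → f (toℕ j)) ≡ sumTo n f
sumFin-toℕ zero    f = refl
sumFin-toℕ (suc n) f = trans (cong (_+_ (f 0)) (sumFin-toℕ n (λ i → f (suc i)))) (sym (sumTo-head n f))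

sum≡sumFin : ∀ n (f : Fin n → ℚ) → sum f ≡ sumFin n f
sum≡sumFin zero    f = refl
sum≡sumFin (suc n) f = cong (_+_ (f fzero)) (sum≡sumFin n (λ i → f (fsuc i)))

×≡ℕ→ℚ* : ∀ n q → n × q ≡ ℕ→ℚ n * q
×≡ℕ→ℚ* zero    q = sym (ℚP.*-zeroˡ q)
×≡ℕ→ℚ* (suc n) q = begin
  q + n × q                 ≡⟨ cong₂ _+_ (sym (ℚP.*-identityˡ q)) (×≡ℕ→ℚ* n q) ⟩
  1ℚ * q + ℕ→ℚ n * q        ≡⟨ ℚP.*-distribʳ-+ q 1ℚ (ℕ→ℚ n) ⟨
  (1ℚ + ℕ→ℚ n) * q          ≡⟨ cong (_* q) (ℕ→ℚ-+ 1 n) ⟨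
  ℕ→ℚ (suc n) * q           ∎
  where open ≡-Reasoning

binomial-theorem : ∀ a b n → (a + b) ^ℚ n ≡ sumTo (suc n) (λ i → ℕ→ℚ (n C i) * (a ^ℚ i * b ^ℚ (n ∸ i)))
binomial-theorem a b n = begin
  (a + b) ^ℚ n                      ≡⟨ ^ℚ≡^ (a + b) n ⟩
  (a + b) ^ n                       ≡⟨ Binomial.theorem n a b ⟩
  Binomial.binomialExpansion a b n  ≡⟨ sum≡sumFin (suc n) (λ k → term (toℕ k)) ⟩
  sumFin (suc n) (λ k → term (toℕ k))
    ≡⟨ sumFin-cong (suc n) (λ k → term≡F (toℕ k)) ⟩
  sumFin (suc n) (λ k → F (toℕ k))  ≡⟨ sumFin-toℕ (suc n) F ⟩
  sumTo (suc n) F                   ∎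
  where
  open ≡-Reasoning
  term F : ℕ → ℚ
  term i = (n C i) × (a ^ i * b ^ (n ∸ i))
  F i = ℕ→ℚ (n C i) * (a ^ℚ i * b ^ℚ (n ∸ i))
  term≡F : ∀ i → term i ≡ F i
  term≡F i = trans (×≡ℕ→ℚ* (n C i) (a ^ i * b ^ (n ∸ i)))
    (cong (ℕ→ℚ (n C i) *_) (sym (cong₂ _*_ (^ℚ≡^ a i) (^ℚ≡^ b (n ∸ i)))))

-- Formal power series over ℚ

Series : Set
Series = ℕ → ℚ

infixl 6 _⊕_
infixl 7 _⊛_ _·_
infix  8 ⊝_

_⊕_ : Series → Series → Series
(f ⊕ g) n = f n + g n

⊝_ : Series → Series
(⊝ f) n = - f n

𝟘 : Series
𝟘 _ = 0ℚ

𝟙 : Series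
𝟙 zero    = 1ℚ
𝟙 (suc _) = 0ℚ

_·_ : ℚ → Series → Series
(c · f) n = c * f n

_⊛_ : Series → Series → Series
(f ⊛ g) n = sumTo (suc n) (λ i → f i * g (n ∸ i))

shift : Series → Series
shift f zero    = 0ℚ
shift f (suc n) = f n

tail : Series → Series
tail f n = f (suc n)

X : Series
X = shift 𝟙

⊛-cong : ∀ {f f′ g g′} → f ≗ f′ → g ≗ g′ → f ⊛ g ≗ f′ ⊛ g′
⊛-cong f≗f′ g≗g′ n = sumTo-cong (suc n) (λ i _ → cong₂ _*_ (f≗f′ i) (g≗g′ (n ∸ i)))

⊛-comm : ∀ f g → f ⊛ g ≗ g ⊛ f
⊛-comm f g n = trans (sumTo-reverse (suc n) (λ i → f i * g (n ∸ i))) (sumTo-cong (suc n) swap)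
  where
  swap : ∀ i → i < suc n → f (n ∸ i) * g (n ∸ (n ∸ i)) ≡ g i * f (n ∸ i)
  swap i (s≤s i≤n) = trans (cong (λ j → f (n ∸ i) * g j) (ℕP.m∸[m∸n]≡n i≤n)) (ℚP.*-comm (f (n ∸ i)) (g i))

⊛-identityˡ : ∀ f → 𝟙 ⊛ f ≗ f
⊛-identityˡ f zero    = trans (ℚP.+-identityˡ (1ℚ * f 0)) (ℚP.*-identityˡ (f 0))
⊛-identityˡ f (suc n) = begin
  (𝟙 ⊛ f) (suc n)                               ≡⟨ sumTo-head (suc n) (λ i → 𝟙 i * f (suc n ∸ i)) ⟩
  1ℚ * f (suc n) + sumTo (suc n) (λ i → 0ℚ * f (n ∸ i))
    ≡⟨ cong₂ _+_ (ℚP.*-identityˡ (f (suc n))) (sumTo-zero (suc n) (λ i _ → ℚP.*-zeroˡ (f (n ∸ i)))) ⟩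
  f (suc n) + 0ℚ                                ≡⟨ ℚP.+-identityʳ (f (suc n)) ⟩
  f (suc n)                                     ∎
  where open ≡-Reasoning

⊛-distribʳ : ∀ h f g → (f ⊕ g) ⊛ h ≗ f ⊛ h ⊕ g ⊛ h
⊛-distribʳ h f g n = trans (sumTo-cong (suc n) (λ i _ → ℚP.*-distribʳ-+ (h (n ∸ i)) (f i) (g i)))
  (sumTo-distrib-+ (suc n) (λ i → f i * h (n ∸ i)) (λ i → g i * h (n ∸ i)))

·-⊛ : ∀ c f g → c · f ⊛ g ≗ c · (f ⊛ g)
·-⊛ c f g n = trans (sumTo-cong (suc n) (λ i _ → ℚP.*-assoc c (f i) (g (n ∸ i))))
  (sym (*-distribˡ-sumTo (suc n) c (λ i → f i * g (n ∸ i))))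

shift-⊛ : ∀ f g → shift f ⊛ g ≗ shift (f ⊛ g)
shift-⊛ f g zero    = trans (ℚP.+-identityˡ (0ℚ * g 0)) (ℚP.*-zeroˡ (g 0))
shift-⊛ f g (suc n) = begin
  (shift f ⊛ g) (suc n)                                   ≡⟨ sumTo-head (suc n) (λ i → shift f i * g (suc n ∸ i)) ⟩
  0ℚ * g (suc n) + (f ⊛ g) n                              ≡⟨ cong (_+ (f ⊛ g) n) (ℚP.*-zeroˡ (g (suc n))) ⟩
  0ℚ + (f ⊛ g) n                                          ≡⟨ ℚP.+-identityˡ ((f ⊛ g) n) ⟩
  (f ⊛ g) n                                               ∎
  where open ≡-Reasoning

⊛-uncons : ∀ f g → f ⊛ g ≗ f 0 · g ⊕ shift (tail f ⊛ g)
⊛-uncons f g zero    = trans (ℚP.+-identityˡ (f 0 * g 0)) (sym (ℚP.+-identityʳ (f 0 * g 0)))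
⊛-uncons f g (suc n) = sumTo-head (suc n) (λ i → f i * g (suc n ∸ i))

⊛-assoc : ∀ f g h → (f ⊛ g) ⊛ h ≗ f ⊛ (g ⊛ h)
⊛-assoc f g h n = begin
  ((f ⊛ g) ⊛ h) n                                    ≡⟨ ⊛-cong {g = h} (⊛-uncons f g) (λ _ → refl) n ⟩
  ((f 0 · g ⊕ shift (tail f ⊛ g)) ⊛ h) n             ≡⟨ ⊛-distribʳ h (f 0 · g) _ n ⟩
  (f 0 · g ⊛ h) n + (shift (tail f ⊛ g) ⊛ h) n       ≡⟨ cong₂ _+_ (·-⊛ (f 0) g h n) (shift-⊛ (tail f ⊛ g) h n) ⟩
  f 0 * (g ⊛ h) n + shift ((tail f ⊛ g) ⊛ h) n       ≡⟨ cong (_+_ (f 0 * (g ⊛ h) n)) (shifted n) ⟩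
  f 0 * (g ⊛ h) n + shift (tail f ⊛ (g ⊛ h)) n       ≡⟨ ⊛-uncons f (g ⊛ h) n ⟨
  (f ⊛ (g ⊛ h)) n                                    ∎
  where
  open ≡-Reasoning
  shifted : shift ((tail f ⊛ g) ⊛ h) ≗ shift (tail f ⊛ (g ⊛ h))
  shifted zero    = refl
  shifted (suc m) = ⊛-assoc (tail f) g h m

seriesRing : CommutativeRing 0ℓ 0ℓ
seriesRing = record
  { Carrier           = Series
  ; _≈_               = _≗_
  ; _+_               = _⊕_
  ; _*_               = _⊛_
  ; -_                = ⊝_
  ; 0#                = 𝟘
  ; 1#                = 𝟙
  ; isCommutativeRing = record
    { isRing = record
      { +-isAbelianGroup = Pointwise.isAbelianGroup ℕ ℚP.+-0-isAbelianGroup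
      ; *-cong           = ⊛-cong
      ; *-assoc          = ⊛-assoc
      ; *-identity       = ⊛-identityˡ , (λ f n → trans (⊛-comm f 𝟙 n) (⊛-identityˡ f n))
      ; distrib          = distribˡ , ⊛-distribʳ
      }
    ; *-comm = ⊛-comm
    }
  }
  where
  distribˡ : ∀ f g h → f ⊛ (g ⊕ h) ≗ f ⊛ g ⊕ f ⊛ h
  distribˡ f g h n = begin
    (f ⊛ (g ⊕ h)) n              ≡⟨ ⊛-comm f (g ⊕ h) n ⟩
    ((g ⊕ h) ⊛ f) n              ≡⟨ ⊛-distribʳ f g h n ⟩
    (g ⊛ f) n + (h ⊛ f) n        ≡⟨ cong₂ _+_ (⊛-comm g f n) (⊛-comm h f n) ⟩
    (f ⊛ g) n + (f ⊛ h) n        ∎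
    where open ≡-Reasoning

X⊛f≗shift : ∀ f → X ⊛ f ≗ shift f
X⊛f≗shift f zero    = shift-⊛ 𝟙 f zero
X⊛f≗shift f (suc n) = trans (shift-⊛ 𝟙 f (suc n)) (⊛-identityˡ f n)

X⊕X⊛-cancel : ∀ {f g} → (X ⊕ X) ⊛ f ≗ (X ⊕ X) ⊛ g → f ≗ g
X⊕X⊛-cancel {f} {g} eq n = begin
  f n                         ≡⟨ halve (f n) ⟩
  + 1 / 2 * (f n + f n)       ≡⟨ cong (+ 1 / 2 *_) (trans (sym (twice f)) (trans (eq (suc n)) (twice g))) ⟩
  + 1 / 2 * (g n + g n)       ≡⟨ halve (g n) ⟨
  g n                         ∎
  where
  open ≡-Reasoning
  halve : ∀ x → x ≡ + 1 / 2 * (x + x)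
  halve = solve-∀ ℚ-ring
  twice : ∀ h → ((X ⊕ X) ⊛ h) (suc n) ≡ h n + h n
  twice h = trans (⊛-distribʳ h X X (suc n)) (cong₂ _+_ (X⊛f≗shift h (suc n)) (X⊛f≗shift h (suc n)))

-- Via κ, ℚ⟦t⟧ is a ℚ-algebra, so the ring solver with rational coefficients applies to series.
κ : ℚ → Series
κ c = c · 𝟙

κ-homomorphism : rawRing -Raw-AlmostCommutative⟶ ACR.fromCommutativeRing seriesRing
κ-homomorphism = record
  { ⟦_⟧    = κ
  ; +-homo = λ a b n → ℚP.*-distribʳ-+ (𝟙 n) a b
  ; *-homo = *-homo
  ; -‿homo = λ a n → sym (ℚP.neg-distribˡ-* a (𝟙 n))
  ; 0-homo = λ n → ℚP.*-zeroˡ (𝟙 n)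
  ; 1-homo = λ n → ℚP.*-identityˡ (𝟙 n)
  }
  where
  *-homo : ∀ a b → κ (a * b) ≗ κ a ⊛ κ b
  *-homo a b n = begin
    a * b * 𝟙 n              ≡⟨ ℚP.*-assoc a b (𝟙 n) ⟩
    a * κ b n                ≡⟨ cong (a *_) (⊛-identityˡ (κ b) n) ⟨
    a * (𝟙 ⊛ κ b) n          ≡⟨ ·-⊛ a 𝟙 (κ b) n ⟨
    (κ a ⊛ κ b) n            ∎
    where open ≡-Reasoning

κ-≟ : ∀ a b → Maybe (κ a ≗ κ b)
κ-≟ a b with a ℚP.≟ b
... | yes refl = just (λ _ → refl)
... | no _     = nothing

module Series-Solver = RingSolver rawRing (ACR.fromCommutativeRing seriesRing) κ-homomorphism κ-≟
module 𝕊 = CommutativeRing seriesRing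
module ≗-Reasoning = SetoidReasoning 𝕊.setoid

·≗κ⊛ : ∀ c f → c · f ≗ κ c ⊛ f
·≗κ⊛ c f n = sym (trans (·-⊛ c 𝟙 f n) (cong (c *_) (⊛-identityˡ f n)))

-- Exponential series

E : ℚ → Series
E a n = a ^ℚ n * inv! n

E-+ : ∀ a b → E a ⊛ E b ≗ E (a + b)
E-+ a b n = begin
  (E a ⊛ E b) n                                 ≡⟨ sumTo-cong (suc n) (λ i i<1+n → term≡ i (ℕP.≤-pred i<1+n)) ⟩
  sumTo (suc n) (λ i → inv! n * F i)            ≡⟨ *-distribˡ-sumTo (suc n) (inv! n) F ⟨
  inv! n * sumTo (suc n) F                      ≡⟨ cong (inv! n *_) (binomial-theorem a b n) ⟨
  inv! n * (a + b) ^ℚ n                         ≡⟨ ℚP.*-comm (inv! n) ((a + b) ^ℚ n) ⟩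
  E (a + b) n                                   ∎
  where
  open ≡-Reasoning
  F : ℕ → ℚ
  F i = ℕ→ℚ (n C i) * (a ^ℚ i * b ^ℚ (n ∸ i))
  regroup₁ : ∀ x y p q → (x * p) * (y * q) ≡ (x * y) * (p * q)
  regroup₁ = solve-∀ ℚ-ring
  regroup₂ : ∀ z c i → z * (c * i) ≡ i * (c * z)
  regroup₂ = solve-∀ ℚ-ring
  term≡ : ∀ i → i ≤ n → E a i * E b (n ∸ i) ≡ inv! n * F i
  term≡ i i≤n = begin
    E a i * E b (n ∸ i)                                 ≡⟨ regroup₁ (a ^ℚ i) (b ^ℚ (n ∸ i)) (inv! i) (inv! (n ∸ i)) ⟩
    (a ^ℚ i * b ^ℚ (n ∸ i)) * (inv! i * inv! (n ∸ i))
      ≡⟨ cong (a ^ℚ i * b ^ℚ (n ∸ i) *_) (nCk*inv!n≡inv!k*inv![n∸k] i≤n) ⟨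
    (a ^ℚ i * b ^ℚ (n ∸ i)) * (ℕ→ℚ (n C i) * inv! n)    ≡⟨ regroup₂ (a ^ℚ i * b ^ℚ (n ∸ i)) (ℕ→ℚ (n C i)) (inv! n) ⟩
    inv! n * F i                                        ∎

E0≗𝟙 : E 0ℚ ≗ 𝟙
E0≗𝟙 zero    = refl
E0≗𝟙 (suc n) = trans (cong (_* inv! (suc n)) (ℚP.*-zeroˡ (0ℚ ^ℚ n))) (ℚP.*-zeroˡ (inv! (suc n)))

E-neg : ∀ a n → E (- a) n ≡ sgn n * E a n
E-neg a n = begin
  (- a) ^ℚ n * inv! n                   ≡⟨ cong (λ x → x ^ℚ n * inv! n) (sym (-1*x≈-x a)) ⟩
  ((- 1ℚ) * a) ^ℚ n * inv! n            ≡⟨ cong (_* inv! n) (^ℚ-distrib-* (- 1ℚ) a n) ⟩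
  (sgn n * a ^ℚ n) * inv! n             ≡⟨ ℚP.*-assoc (sgn n) (a ^ℚ n) (inv! n) ⟩
  sgn n * E a n                         ∎
  where open ≡-Reasoning

E1≡inv! : ∀ n → E 1ℚ n ≡ inv! n
E1≡inv! n = trans (cong (_* inv! n) (1^ℚn≡1 n)) (ℚP.*-identityˡ (inv! n))

E-neg-even : ∀ a m → E (- a) (double m) ≡ E a (double m)
E-neg-even a m = begin
  E (- a) (double m)              ≡⟨ E-neg a (double m) ⟩
  sgn (double m) * E a (double m) ≡⟨ cong (_* E a (double m)) (sgn-double m) ⟩
  1ℚ * E a (double m)             ≡⟨ ℚP.*-identityˡ (E a (double m)) ⟩
  E a (double m)                  ∎
  where open ≡-Reasoning

E-neg-odd : ∀ a m → E (- a) (suc (double m)) ≡ - E a (suc (double m))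
E-neg-odd a m = begin
  E (- a) k                        ≡⟨ E-neg a k ⟩
  (- 1ℚ) * sgn (double m) * E a k  ≡⟨ cong (λ s → (- 1ℚ) * s * E a k) (sgn-double m) ⟩
  (- 1ℚ) * E a k                   ≡⟨ -1*x≈-x (E a k) ⟩
  - E a k                          ∎
  where
  open ≡-Reasoning
  k = suc (double m)

-- Series in t²

-- atT² f is the series f(t²).
atT² : Series → Series
atT² f zero          = f 0
atT² f (suc zero)    = 0ℚ
atT² f (suc (suc n)) = atT² (tail f) n

atT²-double : ∀ f m → atT² f (double m) ≡ f m
atT²-double f zero    = refl
atT²-double f (suc m) = atT²-double (tail f) m

atT²-odd : ∀ f m → atT² f (suc (double m)) ≡ 0ℚ
atT²-odd f zero    = refl
atT²-odd f (suc m) = atT²-odd (tail f) m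

atT²-cong : ∀ {f g} → f ≗ g → atT² f ≗ atT² g
atT²-cong f≗g zero          = f≗g 0
atT²-cong f≗g (suc zero)    = refl
atT²-cong f≗g (suc (suc n)) = atT²-cong (λ k → f≗g (suc k)) n

atT²-⊕ : ∀ f g → atT² (f ⊕ g) ≗ atT² f ⊕ atT² g
atT²-⊕ f g zero          = refl
atT²-⊕ f g (suc zero)    = sym (ℚP.+-identityʳ 0ℚ)
atT²-⊕ f g (suc (suc n)) = atT²-⊕ (tail f) (tail g) n

atT²-· : ∀ c f → atT² (c · f) ≗ c · atT² f
atT²-· c f zero          = refl
atT²-· c f (suc zero)    = sym (ℚP.*-zeroʳ c)
atT²-· c f (suc (suc n)) = atT²-· c (tail f) n

atT²-shift : ∀ f → atT² (shift f) ≗ shift (shift (atT² f))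
atT²-shift f zero          = refl
atT²-shift f (suc zero)    = refl
atT²-shift f (suc (suc n)) = refl

atT²-uncons : ∀ f → atT² f ≗ f 0 · 𝟙 ⊕ shift (shift (atT² (tail f)))
atT²-uncons f zero          = sym (trans (ℚP.+-identityʳ (f 0 * 1ℚ)) (ℚP.*-identityʳ (f 0)))
atT²-uncons f (suc zero)    = sym (trans (ℚP.+-identityʳ (f 0 * 0ℚ)) (ℚP.*-zeroʳ (f 0)))
atT²-uncons f (suc (suc n)) = sym (trans (cong (_+ atT² (tail f) n) (ℚP.*-zeroʳ (f 0))) (ℚP.+-identityˡ _))

shift²-⊛ : ∀ f g → shift (shift f) ⊛ g ≗ shift (shift (f ⊛ g))
shift²-⊛ f g n = trans (shift-⊛ (shift f) g n) (shifted n)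
  where
  shifted : shift (shift f ⊛ g) ≗ shift (shift (f ⊛ g))
  shifted zero    = refl
  shifted (suc m) = shift-⊛ f g m

atT²-⊛ : ∀ f g → atT² (f ⊛ g) ≗ atT² f ⊛ atT² g
atT²-⊛ f g n = sym (begin
  (atT² f ⊛ atT² g) n                                          ≡⟨ ⊛-cong {g = atT² g} (atT²-uncons f) (λ _ → refl) n ⟩
  ((f 0 · 𝟙 ⊕ shift (shift (atT² (tail f)))) ⊛ atT² g) n       ≡⟨ ⊛-distribʳ (atT² g) (f 0 · 𝟙) _ n ⟩
  (f 0 · 𝟙 ⊛ atT² g) n + (shift (shift (atT² (tail f))) ⊛ atT² g) n
    ≡⟨ cong₂ _+_ (trans (·-⊛ (f 0) 𝟙 (atT² g) n) (cong (f 0 *_) (⊛-identityˡ (atT² g) n)))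
                 (shift²-⊛ (atT² (tail f)) (atT² g) n) ⟩
  f 0 * atT² g n + shift (shift (atT² (tail f) ⊛ atT² g)) n    ≡⟨ cong (_+_ (f 0 * atT² g n)) (shifted n) ⟩
  f 0 * atT² g n + shift (shift (atT² (tail f ⊛ g))) n
    ≡⟨ cong₂ _+_ (atT²-· (f 0) g n) (atT²-shift (tail f ⊛ g) n) ⟨
  atT² (f 0 · g) n + atT² (shift (tail f ⊛ g)) n               ≡⟨ atT²-⊕ (f 0 · g) _ n ⟨
  atT² (f 0 · g ⊕ shift (tail f ⊛ g)) n                        ≡⟨ atT²-cong (⊛-uncons f g) n ⟨
  atT² (f ⊛ g) n                                               ∎)
  where
  open ≡-Reasoning
  shifted : shift (shift (atT² (tail f) ⊛ atT² g)) ≗ shift (shift (atT² (tail f ⊛ g)))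
  shifted zero          = refl
  shifted (suc zero)    = refl
  shifted (suc (suc m)) = sym (atT²-⊛ (tail f) g m)

atT²-𝟘 : atT² 𝟘 ≗ 𝟘
atT²-𝟘 zero          = refl
atT²-𝟘 (suc zero)    = refl
atT²-𝟘 (suc (suc n)) = atT²-𝟘 n

atT²-𝟙 : atT² 𝟙 ≗ 𝟙
atT²-𝟙 zero          = refl
atT²-𝟙 (suc zero)    = refl
atT²-𝟙 (suc (suc n)) = atT²-𝟘 n

E-even-part : ∀ a → let c = atT² (λ m → E a (double m)) in c ⊕ c ≗ E a ⊕ E (- a)
E-even-part a n with parity n
... | even m = cong₂ _+_ (atT²-double _ m) (trans (atT²-double _ m) (sym (E-neg-even a m)))
... | odd m  = begin
  c (suc (double m)) + c (suc (double m))   ≡⟨ cong₂ _+_ (atT²-odd _ m) (atT²-odd _ m) ⟩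
  0ℚ                                        ≡⟨ ℚP.+-inverseʳ (E a k) ⟨
  E a k + - E a k                           ≡⟨ cong (_+_ (E a k)) (E-neg-odd a m) ⟨
  E a k + E (- a) k                         ∎
  where
  open ≡-Reasoning
  c = atT² (λ m → E a (double m))
  k = suc (double m)

E-odd-part : ∀ a → (X ⊕ X) ⊛ atT² (λ m → E a (suc (double m))) ≗ E a ⊕ ⊝ E (- a)
E-odd-part a n = trans (⊛-distribʳ s X X n) (trans (cong₂ _+_ (X⊛f≗shift s n) (X⊛f≗shift s n)) (shifted n))
  where
  open ≡-Reasoning
  s = atT² (λ m → E a (suc (double m)))
  shifted : shift s ⊕ shift s ≗ E a ⊕ ⊝ E (- a)
  shifted zero = refl
  shifted (suc k) with parity k
  ... | even m = begin
    s (double m) + s (double m)        ≡⟨ cong₂ _+_ (atT²-double _ m) (atT²-double _ m) ⟩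
    E a j + E a j                      ≡⟨ cong (_+_ (E a j)) (-‿involutive (E a j)) ⟨
    E a j + - - E a j                  ≡⟨ cong (λ x → E a j + - x) (E-neg-odd a m) ⟨
    E a j + - E (- a) j                ∎
    where j = suc (double m)
  ... | odd m = begin
    s (suc (double m)) + s (suc (double m))   ≡⟨ cong₂ _+_ (atT²-odd _ m) (atT²-odd _ m) ⟩
    0ℚ                                        ≡⟨ ℚP.+-inverseʳ (E a j) ⟨
    E a j + - E a j                           ≡⟨ cong (λ x → E a j + - x) (E-neg-even a (suc m)) ⟨
    E a j + - E (- a) j                       ∎
    where j = double (suc m)

-- The Bernoulli generating function

bernTable-suc : ∀ {j n} → j ≤ n → bernTable (suc n) j ≡ bernTable n j
bernTable-suc {j} {n} j≤n with j ℕ.≤ᵇ n | ℕP.≤⇒≤ᵇ j≤n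
... | true | _ = refl

bernTable≡bernoulli : ∀ {j n} → j ≤ n → bernTable n j ≡ bernoulli j
bernTable≡bernoulli j≤n with ℕP.m≤n⇒m<n∨m≡n j≤n
... | inj₂ refl       = refl
... | inj₁ (s≤s j≤n′) = trans (bernTable-suc j≤n′) (bernTable≡bernoulli j≤n′)

1+n≤ᵇn≡false : ∀ n → (suc n ℕ.≤ᵇ n) ≡ false
1+n≤ᵇn≡false zero    = refl
1+n≤ᵇn≡false (suc n) = 1+n≤ᵇn≡false n

bernoulli-suc : ∀ n → bernoulli (suc n) ≡
  - (+ 1 / suc (suc n)) * sumTo (suc n) (λ i → ℕ→ℚ (suc (suc n) C i) * bernoulli i)
bernoulli-suc n rewrite 1+n≤ᵇn≡false n =
  cong (- (+ 1 / suc (suc n)) *_)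
       (sumTo-cong (suc n) (λ i i<1+n → cong (ℕ→ℚ (suc (suc n) C i) *_) (bernTable≡bernoulli (ℕP.≤-pred i<1+n))))

[2+n]C[1+n]≡2+n : ∀ n → suc (suc n) C suc n ≡ suc (suc n)
[2+n]C[1+n]≡2+n n = begin
  suc (suc n) C suc n                   ≡⟨ nCk≡nC[n∸k] (ℕP.n≤1+n (suc n)) ⟩
  suc (suc n) C (suc (suc n) ∸ suc n)   ≡⟨ cong (suc (suc n) C_) (ℕP.m+n∸n≡m 1 (suc n)) ⟩
  suc (suc n) C 1                       ≡⟨ nC1≡n (suc (suc n)) ⟩
  suc (suc n)                           ∎
  where open ≡-Reasoning

bernoulli-recurrence : ∀ n → sumTo (suc (suc n)) (λ i → ℕ→ℚ (suc (suc n) C i) * bernoulli i) ≡ 0ℚ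
bernoulli-recurrence n = begin
  S + ℕ→ℚ (suc (suc n) C suc n) * bernoulli (suc n)
    ≡⟨ cong₂ (λ k b → S + ℕ→ℚ k * b) ([2+n]C[1+n]≡2+n n) (bernoulli-suc n) ⟩
  S + ℕ→ℚ (suc (suc n)) * (- w * S)                   ≡⟨ regroup S (ℕ→ℚ (suc (suc n))) w ⟩
  S - (w * ℕ→ℚ (suc (suc n))) * S                     ≡⟨ cong (λ z → S - z * S) (1/n*n≡1 (suc (suc n))) ⟩
  S - 1ℚ * S                                          ≡⟨ cancel S ⟩
  0ℚ                                                  ∎
  where
  open ≡-Reasoning
  S = sumTo (suc n) (λ i → ℕ→ℚ (suc (suc n) C i) * bernoulli i)
  w = + 1 / suc (suc n)
  regroup : ∀ s m w → s + m * (- w * s) ≡ s - (w * m) * s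
  regroup = solve-∀ ℚ-ring
  cancel : ∀ s → s - 1ℚ * s ≡ 0ℚ
  cancel = solve-∀ ℚ-ring

B[_] : ℚ → Series
B[ a ] n = a ^ℚ n * bernoulli n * inv! n

B⊛E-coefficient : ∀ a n → (B[ a ] ⊛ E a) n ≡ a ^ℚ n * inv! n * sumTo (suc n) (λ i → ℕ→ℚ (n C i) * bernoulli i)
B⊛E-coefficient a n = begin
  (B[ a ] ⊛ E a) n                                    ≡⟨ sumTo-cong (suc n) (λ i i<1+n → term≡ i (ℕP.≤-pred i<1+n)) ⟩
  sumTo (suc n) (λ i → a ^ℚ n * inv! n * F i)         ≡⟨ *-distribˡ-sumTo (suc n) (a ^ℚ n * inv! n) F ⟨
  a ^ℚ n * inv! n * sumTo (suc n) F                   ∎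
  where
  open ≡-Reasoning
  F : ℕ → ℚ
  F i = ℕ→ℚ (n C i) * bernoulli i
  regroup₁ : ∀ p q b i j → (p * b * i) * (q * j) ≡ (p * q) * b * (i * j)
  regroup₁ = solve-∀ ℚ-ring
  regroup₂ : ∀ p b c i → p * b * (c * i) ≡ p * i * (c * b)
  regroup₂ = solve-∀ ℚ-ring
  term≡ : ∀ i → i ≤ n → B[ a ] i * E a (n ∸ i) ≡ a ^ℚ n * inv! n * F i
  term≡ i i≤n = begin
    B[ a ] i * E a (n ∸ i)
      ≡⟨ regroup₁ (a ^ℚ i) (a ^ℚ (n ∸ i)) (bernoulli i) (inv! i) (inv! (n ∸ i)) ⟩
    (a ^ℚ i * a ^ℚ (n ∸ i)) * bernoulli i * (inv! i * inv! (n ∸ i))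
      ≡⟨ cong₂ (λ p q → p * bernoulli i * q) (trans (sym (^ℚ-+ a i (n ∸ i))) (cong (a ^ℚ_) (ℕP.m+[n∸m]≡n i≤n)))
                                              (sym (nCk*inv!n≡inv!k*inv![n∸k] i≤n)) ⟩
    a ^ℚ n * bernoulli i * (ℕ→ℚ (n C i) * inv! n)                ≡⟨ regroup₂ (a ^ℚ n) (bernoulli i) (ℕ→ℚ (n C i)) (inv! n) ⟩
    a ^ℚ n * inv! n * F i                                        ∎

bernoulli-egf : ∀ a → B[ a ] ⊛ E a ≗ B[ a ] ⊕ a · X
bernoulli-egf a zero             = cong (_+_ 1ℚ) (sym (ℚP.*-zeroʳ a))
bernoulli-egf a (suc zero)       = coefficient₁ a
  where
  coefficient₁ : ∀ a → 0ℚ + (1ℚ * 1ℚ * inv! 0) * (a * 1ℚ * inv! 1) + (a * 1ℚ * bernoulli 1 * inv! 1) * (1ℚ * inv! 0)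
                     ≡ a * 1ℚ * bernoulli 1 * inv! 1 + a * 1ℚ
  coefficient₁ = solve-∀ ℚ-ring
bernoulli-egf a (suc (suc m)) = begin
  (B[ a ] ⊛ E a) n                                                 ≡⟨ B⊛E-coefficient a n ⟩
  a ^ℚ n * inv! n * (sumTo n F + ℕ→ℚ (n C n) * bernoulli n)
    ≡⟨ cong₂ (λ s k → a ^ℚ n * inv! n * (s + ℕ→ℚ k * bernoulli n)) (bernoulli-recurrence m) (nCn≡1 n) ⟩
  a ^ℚ n * inv! n * (0ℚ + 1ℚ * bernoulli n)                        ≡⟨ regroup (a ^ℚ n) (inv! n) (bernoulli n) a ⟩
  B[ a ] n + a * 0ℚ                                                ∎
  where
  open ≡-Reasoning
  n = suc (suc m)
  F : ℕ → ℚ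
  F i = ℕ→ℚ (n C i) * bernoulli i
  regroup : ∀ p i b a → p * i * (0ℚ + 1ℚ * b) ≡ p * b * i + a * 0ℚ
  regroup = solve-∀ ℚ-ring

-- Hessenberg determinants

minor : ∀ {n} → (Fin (suc n) → Fin (suc n) → ℚ) → Fin (suc n) → Fin n → Fin n → ℚ
minor M j i k = M (fsuc i) (punchIn j k)

det-cong : ∀ n {M N : Fin n → Fin n → ℚ} → (∀ i j → M i j ≡ N i j) → det n M ≡ det n N
det-cong zero    M≡N = refl
det-cong (suc n) M≡N = sumFin-cong (suc n) (λ j →
  cong₂ (λ a b → sgn (toℕ j) * a * b) (M≡N fzero j) (det-cong n (λ i k → M≡N (fsuc i) (punchIn j k))))

det-zero-column : ∀ n (M : Fin n → Fin n → ℚ) c → (∀ i → M i c ≡ 0ℚ) → det n M ≡ 0ℚ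
det-zero-column (suc n) M c Mic≡0 = sumFin-zero (suc n) term≡0
  where
  term≡0 : ∀ j → sgn (toℕ j) * M fzero j * det n (minor M j) ≡ 0ℚ
  term≡0 j with j Fin.≟ c
  ... | yes refl = trans (cong (λ x → sgn (toℕ j) * x * det n (minor M j)) (Mic≡0 fzero))
                         (trans (cong (_* det n (minor M j)) (ℚP.*-zeroʳ (sgn (toℕ j)))) (ℚP.*-zeroˡ (det n (minor M j))))
  ... | no j≢c   = trans (cong (sgn (toℕ j) * M fzero j *_) (det-zero-column n (minor M j) (punchOut j≢c) minor≡0))
                         (ℚP.*-zeroʳ (sgn (toℕ j) * M fzero j))
    where
    minor≡0 : ∀ i → minor M j i (punchOut j≢c) ≡ 0ℚ
    minor≡0 i = trans (cong (M (fsuc i)) (FinP.punchIn-punchOut j≢c)) (Mic≡0 (fsuc i))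

det-first-column : ∀ n (M : Fin (suc n) → Fin (suc n) → ℚ) → (∀ i → M (fsuc i) fzero ≡ 0ℚ) →
  det (suc n) M ≡ M fzero fzero * det n (λ i k → M (fsuc i) (fsuc k))
det-first-column n M below≡0 = begin
  1ℚ * M fzero fzero * det n (minor M fzero) + rest  ≡⟨ cong (_+_ (1ℚ * M fzero fzero * det n (minor M fzero))) rest≡0 ⟩
  1ℚ * M fzero fzero * det n (minor M fzero) + 0ℚ    ≡⟨ ℚP.+-identityʳ _ ⟩
  1ℚ * M fzero fzero * det n (minor M fzero)         ≡⟨ cong (_* det n (minor M fzero)) (ℚP.*-identityˡ (M fzero fzero)) ⟩
  M fzero fzero * det n (minor M fzero)              ∎
  where
  open ≡-Reasoning
  rest = sumFin n (λ j → sgn (toℕ (fsuc j)) * M fzero (fsuc j) * det n (minor M (fsuc j)))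
  minor≡0 : ∀ {m} (N : Fin (suc m) → Fin (suc m) → ℚ) → (∀ i → N (fsuc i) fzero ≡ 0ℚ) →
            ∀ j → det m (minor N (fsuc j)) ≡ 0ℚ
  minor≡0 {suc m} N below≡0 j = det-zero-column (suc m) (minor N (fsuc j)) fzero below≡0
  rest≡0 : rest ≡ 0ℚ
  rest≡0 = sumFin-zero n (λ j → trans (cong (sgn (toℕ (fsuc j)) * M fzero (fsuc j) *_) (minor≡0 M below≡0 j))
                                      (ℚP.*-zeroʳ (sgn (toℕ (fsuc j)) * M fzero (fsuc j))))

-- A k i j unfolds to hessenberg (toℕ i) (toℕ j).
hessenberg : ℕ → ℕ → ℚ
hessenberg i j = if i ℕ.≤ᵇ j then inv! (2 ℕ.* (j ∸ i) ℕ.+ 3) else (if suc j ℕ.≡ᵇ i then 1ℚ else 0ℚ)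

hessenberg-suc : ∀ i j → hessenberg (suc i) (suc j) ≡ hessenberg i j
hessenberg-suc zero    j = refl
hessenberg-suc (suc i) j = refl

det-hessenberg-minor : ∀ n (j : Fin (suc n)) →
  det n (minor (A (suc n)) j) ≡ D (n ∸ toℕ j)
det-hessenberg-minor n       fzero    = det-cong n (λ i k → hessenberg-suc (toℕ i) (toℕ k))
det-hessenberg-minor (suc n) (fsuc j) = begin
  det (suc n) (minor (A (2 ℕ.+ n)) (fsuc j))              ≡⟨ det-first-column n (minor (A (2 ℕ.+ n)) (fsuc j)) (λ _ → refl) ⟩
  1ℚ * det n (λ i k → hessenberg (2 ℕ.+ toℕ i) (suc (toℕ (punchIn j k))))
    ≡⟨ ℚP.*-identityˡ _ ⟩
  det n (λ i k → hessenberg (2 ℕ.+ toℕ i) (suc (toℕ (punchIn j k))))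
    ≡⟨ det-cong n (λ i k → hessenberg-suc (suc (toℕ i)) (toℕ (punchIn j k))) ⟩
  det n (minor (A (suc n)) j)                             ≡⟨ det-hessenberg-minor n j ⟩
  D (n ∸ toℕ j)                                           ∎
  where open ≡-Reasoning

D-recurrence : ∀ n → D (suc n) ≡ sumTo (suc n) (λ j → sgn j * inv! (2 ℕ.* j ℕ.+ 3) * D (n ∸ j))
D-recurrence n = trans (sumFin-cong (suc n) (λ j → cong (sgn (toℕ j) * hessenberg 0 (toℕ j) *_) (det-hessenberg-minor n j)))
  (sumFin-toℕ (suc n) (λ j → sgn j * inv! (2 ℕ.* j ℕ.+ 3) * D (n ∸ j)))

-- atT² sinhc is sinh t / t.
sinhc : Series
sinhc m = inv! (suc (double m))

signedD : Series
signedD k = sgn k * D k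

sgn[1+n]*sgn[j]≡-sgn[n∸j] : ∀ {n j} → j ≤ n → sgn (suc n) * sgn j ≡ - sgn (n ∸ j)
sgn[1+n]*sgn[j]≡-sgn[n∸j] {n} {j} j≤n = begin
  (- 1ℚ) * sgn n * sgn j                          ≡⟨ cong (λ k → (- 1ℚ) * sgn k * sgn j) (ℕP.m+[n∸m]≡n j≤n) ⟨
  (- 1ℚ) * sgn (j ℕ.+ (n ∸ j)) * sgn j            ≡⟨ cong (λ s → (- 1ℚ) * s * sgn j) (sgn-+ j (n ∸ j)) ⟩
  (- 1ℚ) * (sgn j * sgn (n ∸ j)) * sgn j          ≡⟨ regroup (sgn j) (sgn (n ∸ j)) ⟩
  - (sgn (n ∸ j) * (sgn j * sgn j))               ≡⟨ cong (λ s → - (sgn (n ∸ j) * s)) (sgn*sgn≡1 j) ⟩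
  - (sgn (n ∸ j) * 1ℚ)                            ≡⟨ cong -_ (ℚP.*-identityʳ (sgn (n ∸ j))) ⟩
  - sgn (n ∸ j)                                   ∎
  where
  open ≡-Reasoning
  regroup : ∀ s t → (- 1ℚ) * (s * t) * s ≡ - (t * (s * s))
  regroup = solve-∀ ℚ-ring

sinhc⊛signedD≗𝟙 : sinhc ⊛ signedD ≗ 𝟙
sinhc⊛signedD≗𝟙 zero    = refl
sinhc⊛signedD≗𝟙 (suc n) = begin
  (sinhc ⊛ signedD) (suc n)                 ≡⟨ sumTo-head (suc n) (λ i → sinhc i * signedD (suc n ∸ i)) ⟩
  1ℚ * signedD (suc n) + U                  ≡⟨ cong (_+ U) (trans (ℚP.*-identityˡ (signedD (suc n))) signedD[1+n]≡-U) ⟩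
  - U + U                                   ≡⟨ ℚP.+-inverseˡ U ⟩
  0ℚ                                        ∎
  where
  open ≡-Reasoning
  u : ℕ → ℚ
  u j = sinhc (suc j) * signedD (n ∸ j)
  U = sumTo (suc n) u
  regroup₁ : ∀ σ s x d → σ * (s * x * d) ≡ x * (σ * s * d)
  regroup₁ = solve-∀ ℚ-ring
  regroup₂ : ∀ x s d → x * (- s * d) ≡ (- 1ℚ) * (x * (s * d))
  regroup₂ = solve-∀ ℚ-ring
  index : ∀ j → 2 ℕ.* j ℕ.+ 3 ≡ suc (double (suc j))
  index j = trans (ℕP.+-comm (2 ℕ.* j) 3) (cong (3 ℕ.+_) (sym (double≡2* j)))
  term≡ : ∀ j → j < suc n → sgn (suc n) * (sgn j * inv! (2 ℕ.* j ℕ.+ 3) * D (n ∸ j)) ≡ (- 1ℚ) * u j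
  term≡ j (s≤s j≤n) = begin
    sgn (suc n) * (sgn j * inv! (2 ℕ.* j ℕ.+ 3) * D (n ∸ j))   ≡⟨ regroup₁ (sgn (suc n)) (sgn j) _ (D (n ∸ j)) ⟩
    inv! (2 ℕ.* j ℕ.+ 3) * (sgn (suc n) * sgn j * D (n ∸ j))
      ≡⟨ cong₂ (λ x s → x * (s * D (n ∸ j))) (cong inv! (index j)) (sgn[1+n]*sgn[j]≡-sgn[n∸j] j≤n) ⟩
    sinhc (suc j) * (- sgn (n ∸ j) * D (n ∸ j))                 ≡⟨ regroup₂ (sinhc (suc j)) (sgn (n ∸ j)) (D (n ∸ j)) ⟩
    (- 1ℚ) * u j                                                ∎
  signedD[1+n]≡-U : signedD (suc n) ≡ - U
  signedD[1+n]≡-U = begin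
    sgn (suc n) * D (suc n)                                     ≡⟨ cong (sgn (suc n) *_) (D-recurrence n) ⟩
    sgn (suc n) * sumTo (suc n) (λ j → sgn j * inv! (2 ℕ.* j ℕ.+ 3) * D (n ∸ j))
      ≡⟨ *-distribˡ-sumTo (suc n) (sgn (suc n)) _ ⟩
    sumTo (suc n) (λ j → sgn (suc n) * (sgn j * inv! (2 ℕ.* j ℕ.+ 3) * D (n ∸ j)))
      ≡⟨ sumTo-cong (suc n) term≡ ⟩
    sumTo (suc n) (λ j → (- 1ℚ) * u j)                          ≡⟨ *-distribˡ-sumTo (suc n) (- 1ℚ) u ⟨
    (- 1ℚ) * U                                                  ≡⟨ -1*x≈-x U ⟩
    - U                                                         ∎

-- The generating function identity

cosh3c : Series
cosh3c m = E (ℕ→ℚ 3) (double m)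

combination : Series
combination = B[ ℕ→ℚ 2 ] ⊕ X ⊕ X ⊛ (E (ℕ→ℚ 2) ⊕ ⊝ E (- ℕ→ℚ 2))

-- With u = eᵗ, v = e⁻ᵗ and b = B(2t), expand writes the left side as t(u³ + v³) plus multiples
-- of 1 - uv and of b u² - (b + 2t), both of which vanish.
sinh-identity : (X ⊕ X) ⊛ (atT² sinhc ⊛ combination) ≗ (X ⊕ X) ⊛ atT² cosh3c
sinh-identity = begin
  (X ⊕ X) ⊛ (s ⊛ combination)                               ≈⟨ 𝕊.sym (⊛-assoc (X ⊕ X) s combination) ⟩
  ((X ⊕ X) ⊛ s) ⊛ combination                               ≈⟨ ⊛-cong odd-part combination≗ ⟩
  (u ⊕ ⊝ v) ⊛ (b ⊕ X ⊕ X ⊛ (u ⊛ u ⊕ ⊝ (v ⊛ v)))            ≈⟨ expand u v X b ⟩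
  P ⊕ Q ⊛ (κ 1ℚ ⊕ ⊝ (u ⊛ v)) ⊕ v ⊛ (b ⊛ (u ⊛ u) ⊕ ⊝ β)
    ≈⟨ 𝕊.+-cong (𝕊.+-cong (𝕊.refl {P}) (⊛-cong (𝕊.refl {Q}) (𝕊.+-cong (𝕊.refl {κ 1ℚ}) (𝕊.-‿cong u⊛v≗κ1))))
                (⊛-cong (𝕊.refl {v}) (𝕊.+-cong bernoulli₂ (𝕊.refl {⊝ β}))) ⟩
  P ⊕ Q ⊛ (κ 1ℚ ⊕ ⊝ κ 1ℚ) ⊕ v ⊛ (β ⊕ ⊝ β)                   ≈⟨ cancel P Q v β ⟩
  P                                                         ≈⟨ ⊛-cong (𝕊.refl {X}) (𝕊.+-cong cube₊ cube₋) ⟩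
  X ⊛ (E (ℕ→ℚ 3) ⊕ E (- ℕ→ℚ 3))                           ≈⟨ ⊛-cong (𝕊.refl {X}) (𝕊.sym (E-even-part (ℕ→ℚ 3))) ⟩
  X ⊛ (c ⊕ c)                                               ≈⟨ distrib X c ⟩
  (X ⊕ X) ⊛ c                                               ∎
  where
  open ≗-Reasoning
  open Series-Solver
  2ℚ = ℕ→ℚ 2
  u = E 1ℚ
  v = E (- 1ℚ)
  b = B[ 2ℚ ]
  s = atT² sinhc
  c = atT² cosh3c
  P = X ⊛ (u ⊛ u ⊛ u ⊕ v ⊛ v ⊛ v)
  Q = u ⊛ b ⊕ X ⊛ (u ⊕ v)
  β = b ⊕ κ 2ℚ ⊛ X
  odd-part : (X ⊕ X) ⊛ s ≗ u ⊕ ⊝ v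
  odd-part = 𝕊.trans (⊛-cong (𝕊.refl {X ⊕ X}) (atT²-cong (λ m → sym (E1≡inv! (suc (double m)))))) (E-odd-part 1ℚ)
  combination≗ : combination ≗ b ⊕ X ⊕ X ⊛ (u ⊛ u ⊕ ⊝ (v ⊛ v))
  combination≗ = 𝕊.+-cong (𝕊.refl {b ⊕ X})
    (⊛-cong (𝕊.refl {X}) (𝕊.+-cong (𝕊.sym (E-+ 1ℚ 1ℚ)) (𝕊.-‿cong (𝕊.sym (E-+ (- 1ℚ) (- 1ℚ))))))
  u⊛v≗κ1 : u ⊛ v ≗ κ 1ℚ
  u⊛v≗κ1 = 𝕊.trans (E-+ 1ℚ (- 1ℚ)) (𝕊.trans E0≗𝟙 (λ n → sym (ℚP.*-identityˡ (𝟙 n))))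
  bernoulli₂ : b ⊛ (u ⊛ u) ≗ β
  bernoulli₂ = 𝕊.trans (⊛-cong (𝕊.refl {b}) (E-+ 1ℚ 1ℚ))
                       (𝕊.trans (bernoulli-egf 2ℚ) (𝕊.+-cong (𝕊.refl {b}) (·≗κ⊛ 2ℚ X)))
  cube₊ : u ⊛ u ⊛ u ≗ E (ℕ→ℚ 3)
  cube₊ = 𝕊.trans (⊛-cong (E-+ 1ℚ 1ℚ) (𝕊.refl {u})) (E-+ 2ℚ 1ℚ)
  cube₋ : v ⊛ v ⊛ v ≗ E (- ℕ→ℚ 3)
  cube₋ = 𝕊.trans (⊛-cong (E-+ (- 1ℚ) (- 1ℚ)) (𝕊.refl {v})) (E-+ (- 2ℚ) (- 1ℚ))
  expand : ∀ u v x b →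
    (u ⊕ ⊝ v) ⊛ (b ⊕ x ⊕ x ⊛ (u ⊛ u ⊕ ⊝ (v ⊛ v))) ≗
    x ⊛ (u ⊛ u ⊛ u ⊕ v ⊛ v ⊛ v) ⊕ (u ⊛ b ⊕ x ⊛ (u ⊕ v)) ⊛ (κ 1ℚ ⊕ ⊝ (u ⊛ v))
      ⊕ v ⊛ (b ⊛ (u ⊛ u) ⊕ ⊝ (b ⊕ κ 2ℚ ⊛ x))
  expand = solve 4 (λ u v x b →
    (u :- v) :* (b :+ x :+ x :* (u :* u :- v :* v)) :=
    x :* (u :* u :* u :+ v :* v :* v) :+ (u :* b :+ x :* (u :+ v)) :* (con 1ℚ :- u :* v)
      :+ v :* (b :* (u :* u) :- (b :+ con 2ℚ :* x)))
    𝕊.refl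
  cancel : ∀ p q v β → p ⊕ q ⊛ (κ 1ℚ ⊕ ⊝ κ 1ℚ) ⊕ v ⊛ (β ⊕ ⊝ β) ≗ p
  cancel = solve 4 (λ p q v β → p :+ q :* (con 1ℚ :- con 1ℚ) :+ v :* (β :- β) := p) 𝕊.refl
  distrib : ∀ x c → x ⊛ (c ⊕ c) ≗ (x ⊕ x) ⊛ c
  distrib = solve 2 (λ x c → x :* (c :+ c) := (x :+ x) :* c) 𝕊.refl

combination≗cosh3⊛signedD : combination ≗ atT² cosh3c ⊛ atT² signedD
combination≗cosh3⊛signedD = begin
  combination                       ≈⟨ 𝕊.sym (⊛-identityˡ combination) ⟩
  𝟙 ⊛ combination                   ≈⟨ ⊛-cong (𝕊.sym s⊛t≗𝟙) (𝕊.refl {combination}) ⟩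
  (s ⊛ t) ⊛ combination             ≈⟨ swap s t combination ⟩
  (s ⊛ combination) ⊛ t             ≈⟨ ⊛-cong (X⊕X⊛-cancel {s ⊛ combination} {atT² cosh3c} sinh-identity) (𝕊.refl {t}) ⟩
  atT² cosh3c ⊛ t                   ∎
  where
  open ≗-Reasoning
  open Series-Solver
  s = atT² sinhc
  t = atT² signedD
  s⊛t≗𝟙 : s ⊛ t ≗ 𝟙
  s⊛t≗𝟙 = 𝕊.trans (𝕊.sym (atT²-⊛ sinhc signedD)) (𝕊.trans (atT²-cong sinhc⊛signedD≗𝟙) atT²-𝟙)
  swap : ∀ s t h → (s ⊛ t) ⊛ h ≗ (s ⊛ h) ⊛ t
  swap = solve 3 (λ s t h → (s :* t) :* h := (s :* h) :* t) 𝕊.refl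

Dsum : ℕ → ℚ
Dsum p = sumTo p (λ i → sgn (suc i) * D (suc i) * ((+ 1 / 3) ^ℚ (2 ℕ.* suc i)) * inv! (2 ℕ.* (p ∸ suc i)))

signedD⊛cosh3c : ∀ p → (signedD ⊛ cosh3c) p ≡ ℕ→ℚ 3 ^ℚ double p * inv! (double p) + ℕ→ℚ 3 ^ℚ double p * Dsum p
signedD⊛cosh3c p = begin
  (signedD ⊛ cosh3c) p                                        ≡⟨ sumTo-head p (λ i → signedD i * cosh3c (p ∸ i)) ⟩
  1ℚ * cosh3c p + sumTo p (λ i → signedD (suc i) * cosh3c (p ∸ suc i))
    ≡⟨ cong₂ _+_ (ℚP.*-identityˡ (cosh3c p)) (sumTo-cong p term≡) ⟩
  cosh3c p + sumTo p (λ i → three ^ℚ double p * θ i)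
    ≡⟨ cong (_+_ (cosh3c p)) (*-distribˡ-sumTo p (three ^ℚ double p) θ) ⟨
  cosh3c p + three ^ℚ double p * Dsum p                       ∎
  where
  open ≡-Reasoning
  three = ℕ→ℚ 3
  third = + 1 / 3
  θ : ℕ → ℚ
  θ i = sgn (suc i) * D (suc i) * (third ^ℚ (2 ℕ.* suc i)) * inv! (2 ℕ.* (p ∸ suc i))
  regroup : ∀ a b σ x ι → (a * b) * (σ * x * ι) ≡ σ * (a * ι) * (b * x)
  regroup = solve-∀ ℚ-ring
  term≡ : ∀ i → i < p → signedD (suc i) * cosh3c (p ∸ suc i) ≡ three ^ℚ double p * θ i
  term≡ i i<p = sym (begin
    three ^ℚ double p * θ i
      ≡⟨ cong (λ k → three ^ℚ k * θ i) (trans (cong double (sym (ℕP.m∸n+n≡m i<p))) (double-+ m j)) ⟩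
    three ^ℚ (double m ℕ.+ double j) * θ i
      ≡⟨ cong₂ _*_ (^ℚ-+ three (double m) (double j))
                   (cong₂ (λ a b → signedD j * (third ^ℚ a) * inv! b) (sym (double≡2* j)) (sym (double≡2* m))) ⟩
    (three ^ℚ double m * three ^ℚ double j) * (signedD j * third ^ℚ double j * inv! (double m))
      ≡⟨ regroup (three ^ℚ double m) (three ^ℚ double j) (signedD j) (third ^ℚ double j) (inv! (double m)) ⟩
    signedD j * cosh3c m * (three ^ℚ double j * third ^ℚ double j)
      ≡⟨ cong (signedD j * cosh3c m *_) (trans (sym (^ℚ-distrib-* three third (double j))) (1^ℚn≡1 (double j))) ⟩
    signedD j * cosh3c m * 1ℚ                                    ≡⟨ ℚP.*-identityʳ (signedD j * cosh3c m) ⟩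
    signedD j * cosh3c m                                         ∎)
    where
    j = suc i
    m = p ∸ suc i

combination-coefficient : ∀ k → let n = double (suc k); j = suc (double k) in
  combination n ≡ B[ ℕ→ℚ 2 ] n + 0ℚ + (E (ℕ→ℚ 2) j + E (ℕ→ℚ 2) j)
combination-coefficient k = cong (_+_ (B[ ℕ→ℚ 2 ] (suc j) + 0ℚ)) (begin
  (X ⊛ (E (ℕ→ℚ 2) ⊕ ⊝ E (- ℕ→ℚ 2))) (suc j)    ≡⟨ X⊛f≗shift (E (ℕ→ℚ 2) ⊕ ⊝ E (- ℕ→ℚ 2)) (suc j) ⟩
  E (ℕ→ℚ 2) j + - E (- ℕ→ℚ 2) j                 ≡⟨ cong (λ x → E (ℕ→ℚ 2) j + - x) (E-neg-odd (ℕ→ℚ 2) k) ⟩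
  E (ℕ→ℚ 2) j + - - E (ℕ→ℚ 2) j                 ≡⟨ cong (_+_ (E (ℕ→ℚ 2) j)) (-‿involutive (E (ℕ→ℚ 2) j)) ⟩
  E (ℕ→ℚ 2) j + E (ℕ→ℚ 2) j                     ∎)
  where
  open ≡-Reasoning
  j = suc (double k)

coefficients-of-t²ᵖ : ∀ q → let p = suc q; n = double p; j = suc (double q) in
  B[ ℕ→ℚ 2 ] n + 0ℚ + (E (ℕ→ℚ 2) j + E (ℕ→ℚ 2) j) ≡ ℕ→ℚ 3 ^ℚ n * inv! n + ℕ→ℚ 3 ^ℚ n * Dsum p
coefficients-of-t²ᵖ q = begin
  B[ ℕ→ℚ 2 ] n + 0ℚ + (E (ℕ→ℚ 2) j + E (ℕ→ℚ 2) j)  ≡⟨ combination-coefficient q ⟨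
  combination n                                     ≡⟨ combination≗cosh3⊛signedD n ⟩
  (atT² cosh3c ⊛ atT² signedD) n                    ≡⟨ atT²-⊛ cosh3c signedD n ⟨
  atT² (cosh3c ⊛ signedD) n                         ≡⟨ atT²-double (cosh3c ⊛ signedD) p ⟩
  (cosh3c ⊛ signedD) p                              ≡⟨ ⊛-comm cosh3c signedD p ⟩
  (signedD ⊛ cosh3c) p                              ≡⟨ signedD⊛cosh3c p ⟩
  ℕ→ℚ 3 ^ℚ n * inv! n + ℕ→ℚ 3 ^ℚ n * Dsum p         ∎
  where
  open ≡-Reasoning
  p = suc q
  n = double p
  j = suc (double q)

bernoulli-from-coefficients : ∀ j S → let n = suc j in
  B[ ℕ→ℚ 2 ] n + 0ℚ + (E (ℕ→ℚ 2) j + E (ℕ→ℚ 2) j) ≡ ℕ→ℚ 3 ^ℚ n * inv! n + ℕ→ℚ 3 ^ℚ n * S →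
  bernoulli n ≡ - ℕ→ℚ n + (+ 3 / 2) ^ℚ n * (1ℚ + ℕ→ℚ (n !) * S)
bernoulli-from-coefficients j S coefficients = sym (begin
  - m + a * (1ℚ + N * S)                                      ≡⟨ cong₂ (λ x y → - m + x * (y + N * S)) (sym hu≡a) (sym (inv!*n!≡1 n)) ⟩
  - m + h * u * (i * N + N * S)                               ≡⟨ regroup₁ m h u i N S ⟩
  - m + h * N * (u * i + u * S)                               ≡⟨ cong (λ x → - m + h * N * x) coefficients ⟨
  - m + h * N * (ℕ→ℚ 2 * t * B * i + 0ℚ + (t * i′ + t * i′))  ≡⟨ regroup₂ m h N t B i i′ ⟩
  - m + h * (ℕ→ℚ 2 * t) * (B * (i * N) + i′ * N)              ≡⟨ cong₂ (λ x y → - m + x * (B * y + i′ * N)) ht≡1 (inv!*n!≡1 n) ⟩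
  - m + 1ℚ * (B * 1ℚ + i′ * N)                                ≡⟨ cong (λ x → - m + 1ℚ * (B * 1ℚ + x)) (inv!*[1+n]!≡1+n j) ⟩
  - m + 1ℚ * (B * 1ℚ + m)                                     ≡⟨ regroup₃ m B ⟩
  B                                                           ∎)
  where
  open ≡-Reasoning
  n = suc j
  B = bernoulli n; m = ℕ→ℚ n; N = ℕ→ℚ (n !); i = inv! n; i′ = inv! j
  t = ℕ→ℚ 2 ^ℚ j; u = ℕ→ℚ 3 ^ℚ n; h = (+ 1 / 2) ^ℚ n; a = (+ 3 / 2) ^ℚ n
  ht≡1 : h * (ℕ→ℚ 2 * t) ≡ 1ℚ
  ht≡1 = trans (sym (^ℚ-distrib-* (+ 1 / 2) (ℕ→ℚ 2) n)) (1^ℚn≡1 n)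
  hu≡a : h * u ≡ a
  hu≡a = sym (^ℚ-distrib-* (+ 1 / 2) (ℕ→ℚ 3) n)
  regroup₁ : ∀ m h u i N S → - m + h * u * (i * N + N * S) ≡ - m + h * N * (u * i + u * S)
  regroup₁ = solve-∀ ℚ-ring
  regroup₂ : ∀ m h N t B i i′ →
    - m + h * N * (ℕ→ℚ 2 * t * B * i + 0ℚ + (t * i′ + t * i′)) ≡ - m + h * (ℕ→ℚ 2 * t) * (B * (i * N) + i′ * N)
  regroup₂ = solve-∀ ℚ-ring
  regroup₃ : ∀ m B → - m + 1ℚ * (B * 1ℚ + m) ≡ B
  regroup₃ = solve-∀ ℚ-ring

mainTheorem1 : (p : ℕ) → 1 ≤ p →
    bernoulli (2 ℕ.* p) ≡
      - ℕ→ℚ (2 ℕ.* p)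
        + (((+ 3) / 2) ^ℚ (2 ℕ.* p))
          * (1ℚ + ℕ→ℚ ((2 ℕ.* p) !)
               * sumTo p (λ i → sgn (ℕ.suc i) * D (ℕ.suc i)
                                 * (((+ 1) / 3) ^ℚ (2 ℕ.* ℕ.suc i))
                                 * inv! (2 ℕ.* (p ∸ ℕ.suc i))))
mainTheorem1 zero    ()
mainTheorem1 (suc q) _ =
  subst (λ n → bernoulli n ≡ - ℕ→ℚ n + (+ 3 / 2) ^ℚ n * (1ℚ + ℕ→ℚ (n !) * Dsum (suc q))) (double≡2* (suc q))
        (bernoulli-from-coefficients (suc (double q)) (Dsum (suc q)) (coefficients-of-t²ᵖ q))
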